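{- Let $\varphi=\frac{1+\sqrt5}{2}$ and $n\geq 0$. For a binary word $\mathbf c=c_1\cdots c_m\in\{0,1\}^m$ let $[\mathbf c]:=\{\mathbf d=d_1\cdots d_m\in\{0,1\}^m : \sum_{i=1}^m d_i\varphi^{ -i}=\sum_{i=1}^m c_i\varphi^{ -i}\}$. Call a finite binary word greedy if it does not contain $011$ as a factor (block of consecutive letters), let $\mathbf G_m$ be the set of greedy words of length $m$, and for $h\geq 0$ let $\mathbf G_m^h$ be the set of words in $\mathbf G_m$ whose last $h+1$ letters are $1\,0^h$ (a $1$ followed by $h$ zeros). Then, for $\mathbf c\in\{0,1\}^n$: (i) if $\mathbf c1\in\mathbf G_{n+1}^0$, then $\#[\mathbf c1]=\#[\mathbf c]$; (ii) if $\mathbf c0\in\mathbf G_{n+1}^1$, then $\#[\mathbf c0]=\#[\mathbf c]$; (iii) if $\mathbf c\in\mathbf G_n^h$ for some $h\geq 0$, then $\#[\mathbf c00]\geq\#[\mathbf c]+1$.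
   Context: $\varphi$ is the golden mean, the largest root of $x^2=x+1$. Words are concatenated: $\mathbf c1$, $\mathbf c0$, $\mathbf c00$ denote $\mathbf c$ followed by the indicated letters. $[\mathbf c]$ is the class of all binary words of the same length as $\mathbf c$ representing the same number in base $\varphi$ (equivalently, the words $\mathbf d$ with $f_{d_1}\circ\cdots\circ f_{d_m}([0,\varphi])=f_{c_1}\circ\cdots\circ f_{c_m}([0,\varphi])$, where $f_i(x)=(x+i)/\varphi$). -}

module Defs where

open import Data.Bool using (Bool; true; false)
open import Data.Nat using (ℕ; zero; suc; _+_)
open import Data.Nat.Properties using (_≟_)
open import Data.Product using (_×_; _,_; ∃-syntax)
open import Data.Product.Properties using (≡-dec)
open import Data.List using (List; []; _∷_; _++_; map; filter; length; replicate)
open import Data.Vec using (Vec; toList)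
import Data.Vec as V
open import Relation.Binary.PropositionalEquality using (_≡_)
open import Relation.Nullary using (¬_)

bit : Bool → ℕ
bit true  = 1
bit false = 0

-- Elements of ℤ[φ] with nonnegative coefficients: (a , b) represents a + bφ.
-- Since 1, φ are linearly independent over ℚ, equality of such numbers
-- is equality of the coefficient pairs.
-- Horner evaluation: for d₁⋯dₘ this computes Σ dᵢ φ^(m-i) = φ^m · Σ dᵢ φ^(-i),
-- using φ·(a + bφ) = b + (a+b)φ.
horner : ℕ × ℕ → List Bool → ℕ × ℕ
horner acc [] = acc
horner (a , b) (d ∷ ds) = horner (b + bit d , a + b) ds

value : ∀ {m} → Vec Bool m → ℕ × ℕ
value w = horner (0 , 0) (toList w)

allWords : (m : ℕ) → List (Vec Bool m)
allWords zero = V.[] ∷ []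
allWords (suc m) = map (false V.∷_) (allWords m) ++ map (true V.∷_) (allWords m)

classSize : ∀ {m} → Vec Bool m → ℕ
classSize {m} c = length (filter (λ d → ≡-dec _≟_ _≟_ (value d) (value c)) (allWords m))

Greedy : ∀ {m} → Vec Bool m → Set
Greedy w = ¬ (∃[ xs ] ∃[ ys ] toList w ≡ xs ++ (false ∷ true ∷ true ∷ []) ++ ys)

InG : ∀ {m} → ℕ → Vec Bool m → Set
InG h w = Greedy w × (∃[ p ] toList w ≡ p ++ (true ∷ replicate h false))

{-# OPTIONS --safe #-}
-- Sorting the representatives of [c x] by their last letter gives
-- #[c x] = #[c] + #{d : d (not x) ∈ [c x]}, so (i) and (ii) say that no such d exists and (iii)
-- that c0 or c00 has one; for (iii) it comes from rewriting 100 as 011 (φ⁻¹ = φ⁻² + φ⁻³) at the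
-- last 1 of c.  For (i) and (ii), d0 ∈ [c1] resp. d1 ∈ [c0] means Σ (dᵢ − cᵢ) φ^(n−i) = φ⁻¹
-- resp. −φ⁻¹.  The partial sums evolve by D ↦ φ D + (dᵢ − cᵢ); once the coefficients of D in the
-- basis 1, φ are large and of one sign they stay so, all other values that occur are finitely
-- many, and paired with the state of an automaton detecting 011 in c they are listed and checked
-- by evaluation.  There φ⁻¹ only occurs when c ends in 01 and −φ⁻¹ only when c ends in 0, which
-- greediness of c1, resp. c0 with c ending in 1, excludes.
module Submission where

open import Data.Bool using (Bool; true; false; not)
open import Data.Integer using (ℤ; +_; -[1+_]; 0ℤ; 1ℤ; -1ℤ; _⊖_)
import Data.Integer as ℤ
import Data.Integer.Properties as ℤ
import Data.Integer.Tactic.RingSolver as ℤ-Solver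
open import Data.List using (List; []; _∷_; _++_; [_]; map; filter; length; foldl)
import Data.List as List
import Data.List.Properties as List
open import Data.List.Membership.Propositional using (_∈_; lose)
open import Data.List.Membership.Propositional.Properties using (∈-map⁺; ∈-++⁺ˡ; ∈-++⁺ʳ; ∈-++⁻)
open import Data.List.Relation.Unary.All as All using (All)
open import Data.List.Relation.Unary.Any using (here; there)
open import Data.Nat using (ℕ; zero; suc; _+_; _≤_; _<_; _≥_; z≤n)
import Data.Nat.Properties as ℕ
import Data.Nat.Tactic.RingSolver as ℕ-Solver
open import Data.Product using (_×_; _,_; proj₁; proj₂; ∃-syntax)
open import Data.Product.Properties using (≡-dec)
open import Data.List.Membership.DecPropositional (≡-dec ℤ._≟_ ℤ._≟_) using (_∈?_)
open import Data.Sum using (_⊎_; inj₁; inj₂)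
open import Data.Vec using (Vec; []; _∷_; _∷ʳ_; toList; initLast)
import Data.Vec.Properties as Vec
open import Function using (_∘_; id)
open import Level using (Level)
open import Algebra.Properties.CommutativeSemigroup ℕ.+-commutativeSemigroup using (interchange)
open import Relation.Binary.Definitions using (DecidableEquality)
open import Relation.Binary.PropositionalEquality
  using (_≡_; _≢_; refl; sym; trans; cong; cong₂; subst; subst₂; module ≡-Reasoning)
open import Relation.Nullary using (¬_; Dec; yes; no; contradiction)
open import Relation.Nullary.Decidable using (from-yes; from-no; map′; _×-dec_; _⊎-dec_)
open import Relation.Unary using (Pred; Decidable; _≐_)
open import Defs

private
  variable
    p : Level
    m n : ℕ

open ≡-Reasoning

infix 4 _~_
_~_ : Vec Bool n → Vec Bool n → Set
d ~ c = value d ≡ value c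

horner-++ : ∀ v xs ys → horner v (xs ++ ys) ≡ horner (horner v xs) ys
horner-++ v        []       ys = refl
horner-++ (a , b) (x ∷ xs) ys = horner-++ _ xs ys

value-∷ʳ : ∀ (w : Vec Bool m) x → value (w ∷ʳ x) ≡ horner (value w) [ x ]
value-∷ʳ w x = trans (cong (horner (0 , 0)) (Vec.toList-∷ʳ x w)) (horner-++ (0 , 0) (toList w) [ x ])

horner-[-]-injective : ∀ v w x → horner v [ x ] ≡ horner w [ x ] → v ≡ w
horner-[-]-injective (a , b) (a′ , b′) x eq with ℕ.+-cancelʳ-≡ (bit x) b b′ (cong proj₁ eq)
... | refl = cong (_, b) (ℕ.+-cancelʳ-≡ b a a′ (cong proj₂ eq))

~-∷ʳ : ∀ (d c : Vec Bool n) x → d ~ c → d ∷ʳ x ~ c ∷ʳ x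
~-∷ʳ d c x d~c = begin
  value (d ∷ʳ x)         ≡⟨ value-∷ʳ d x ⟩
  horner (value d) [ x ] ≡⟨ cong (λ v → horner v [ x ]) d~c ⟩
  horner (value c) [ x ] ≡⟨ value-∷ʳ c x ⟨
  value (c ∷ʳ x)         ∎

~-∷ʳ⁻¹ : ∀ (d c : Vec Bool n) x → d ∷ʳ x ~ c ∷ʳ x → d ~ c
~-∷ʳ⁻¹ d c x dx~cx =
  horner-[-]-injective _ _ x (trans (sym (value-∷ʳ d x)) (trans dx~cx (value-∷ʳ c x)))

horner-011≡100 : ∀ v → horner (horner (horner v [ false ]) [ true ]) [ true ]
                     ≡ horner (horner (horner v [ true ]) [ false ]) [ false ]
horner-011≡100 (a , b) = cong₂ _,_ (lhs a b) (rhs a b)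
  where
  lhs : ∀ a b → b + 0 + (a + b) + 1 ≡ b + 1 + (a + b) + 0
  lhs = ℕ-Solver.solve-∀
  rhs : ∀ a b → a + b + 1 + (b + 0 + (a + b)) ≡ a + b + 0 + (b + 1 + (a + b))
  rhs = ℕ-Solver.solve-∀

011~100 : ∀ (w : Vec Bool m) → w ∷ʳ false ∷ʳ true ∷ʳ true ~ w ∷ʳ true ∷ʳ false ∷ʳ false
011~100 w rewrite value-∷ʳ (w ∷ʳ false ∷ʳ true) true | value-∷ʳ (w ∷ʳ false) true | value-∷ʳ w false
                | value-∷ʳ (w ∷ʳ true ∷ʳ false) false | value-∷ʳ (w ∷ʳ true) false | value-∷ʳ w true
  = horner-011≡100 (value w)

length-filter-map : ∀ {a b p} {A : Set a} {B : Set b} {P : Pred B p} (P? : Decidable P) (f : A → B) xs →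
                    length (filter P? (map f xs)) ≡ length (filter (P? ∘ f) xs)
length-filter-map P? f []       = refl
length-filter-map P? f (x ∷ xs) with Dec.does (P? (f x))
... | true  = cong suc (length-filter-map P? f xs)
... | false = length-filter-map P? f xs

countWords : ∀ {m p} {P : Pred (Vec Bool m) p} → Decidable P → ℕ
countWords {m} P? = length (filter P? (allWords m))

∈-allWords : ∀ (w : Vec Bool m) → w ∈ allWords m
∈-allWords []          = here refl
∈-allWords (false ∷ w) = ∈-++⁺ˡ (∈-map⁺ (false ∷_) (∈-allWords w))
∈-allWords (true ∷ w)  = ∈-++⁺ʳ (map (false ∷_) (allWords _)) (∈-map⁺ (true ∷_) (∈-allWords w))

countWords-cong : ∀ {q} {P : Pred (Vec Bool m) p} {Q : Pred (Vec Bool m) q}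
                  (P? : Decidable P) (Q? : Decidable Q) → P ≐ Q → countWords P? ≡ countWords Q?
countWords-cong {m = m} P? Q? P≐Q = cong length (List.filter-≐ P? Q? P≐Q (allWords m))

countWords-none : ∀ {P : Pred (Vec Bool m) p} (P? : Decidable P) → (∀ w → ¬ P w) → countWords P? ≡ 0
countWords-none {m = m} P? ¬P = cong length (List.filter-none P? (All.universal ¬P (allWords m)))

countWords-pos : ∀ {P : Pred (Vec Bool m) p} (P? : Decidable P) {w} → P w → 0 < countWords P?
countWords-pos P? {w} Pw = List.filter-some P? (lose (∈-allWords w) Pw)

countWords-∷ : ∀ {P : Pred (Vec Bool (suc m)) p} (P? : Decidable P) →
               countWords P? ≡ countWords (P? ∘ (false ∷_)) + countWords (P? ∘ (true ∷_))
countWords-∷ {m = m} P? = begin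
  length (filter P? (map (false ∷_) (allWords m) ++ map (true ∷_) (allWords m)))
    ≡⟨ cong length (List.filter-++ P? (map (false ∷_) (allWords m)) _) ⟩
  length (filter P? (map (false ∷_) (allWords m)) ++ filter P? (map (true ∷_) (allWords m)))
    ≡⟨ List.length-++ (filter P? (map (false ∷_) (allWords m))) ⟩
  length (filter P? (map (false ∷_) (allWords m))) + length (filter P? (map (true ∷_) (allWords m)))
    ≡⟨ cong₂ _+_ (length-filter-map P? _ (allWords m)) (length-filter-map P? _ (allWords m)) ⟩
  countWords (P? ∘ (false ∷_)) + countWords (P? ∘ (true ∷_)) ∎

countWords-∷ʳ : ∀ {P : Pred (Vec Bool (suc m)) p} (P? : Decidable P) →
                countWords P? ≡ countWords (P? ∘ (_∷ʳ false)) + countWords (P? ∘ (_∷ʳ true))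
countWords-∷ʳ {m = zero} {P = P} P? =
  trans (countWords-∷ P?) (cong₂ _+_ (countWords-cong (P? ∘ (false ∷_)) (P? ∘ (_∷ʳ false)) ∷≐∷ʳ)
                                    (countWords-cong (P? ∘ (true ∷_)) (P? ∘ (_∷ʳ true)) ∷≐∷ʳ))
  where
  -- x ∷ w and w ∷ʳ x only agree after matching w : Vec Bool 0 with [].
  ∷≐∷ʳ : ∀ {x} → (P ∘ (x ∷_)) ≐ (P ∘ (_∷ʳ x))
  ∷≐∷ʳ = (λ { {[]} → id }) , (λ { {[]} → id })
countWords-∷ʳ {m = suc m} P? = begin
  countWords P?
    ≡⟨ countWords-∷ P? ⟩
  countWords (P? ∘ (false ∷_)) + countWords (P? ∘ (true ∷_))
    ≡⟨ cong₂ _+_ (countWords-∷ʳ (P? ∘ (false ∷_))) (countWords-∷ʳ (P? ∘ (true ∷_))) ⟩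
  (#[ false , false ] + #[ false , true ]) + (#[ true , false ] + #[ true , true ])
    ≡⟨ interchange #[ false , false ] _ _ _ ⟩
  (#[ false , false ] + #[ true , false ]) + (#[ false , true ] + #[ true , true ])
    ≡⟨ cong₂ _+_ (countWords-∷ (P? ∘ (_∷ʳ false))) (countWords-∷ (P? ∘ (_∷ʳ true))) ⟨
  countWords (P? ∘ (_∷ʳ false)) + countWords (P? ∘ (_∷ʳ true)) ∎
  where
  #[_,_] : Bool → Bool → ℕ
  #[ x , y ] = countWords (λ w → P? (x ∷ (w ∷ʳ y)))

_≟ᵥ_ : DecidableEquality (ℕ × ℕ)
_≟ᵥ_ = ≡-dec ℕ._≟_ ℕ._≟_

flipCount : Vec Bool n → Bool → ℕ
flipCount {n} c x = countWords {n} (λ d → value (d ∷ʳ not x) ≟ᵥ value (c ∷ʳ x))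

countWords-∷ʳ~∷ʳ : ∀ (c : Vec Bool n) x →
                   countWords {n} (λ d → value (d ∷ʳ x) ≟ᵥ value (c ∷ʳ x)) ≡ classSize c
countWords-∷ʳ~∷ʳ c x =
  countWords-cong _ _ ((λ {d} → ~-∷ʳ⁻¹ d c x) , (λ {d} → ~-∷ʳ d c x))

classSize-∷ʳ : ∀ (c : Vec Bool n) x → classSize (c ∷ʳ x) ≡ classSize c + flipCount c x
classSize-∷ʳ {n} c false =
  trans (countWords-∷ʳ {m = n} _) (cong (_+ flipCount c false) (countWords-∷ʳ~∷ʳ c false))
classSize-∷ʳ {n} c true =
  trans (countWords-∷ʳ {m = n} _)
        (trans (cong (_+_ (flipCount c true)) (countWords-∷ʳ~∷ʳ c true))
               (ℕ.+-comm (flipCount c true) (classSize c)))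

classSize-∷ʳ-≡ : ∀ (c : Vec Bool n) x → (∀ d → ¬ d ∷ʳ not x ~ c ∷ʳ x) →
                 classSize (c ∷ʳ x) ≡ classSize c
classSize-∷ʳ-≡ c x noFlip = begin
  classSize (c ∷ʳ x)            ≡⟨ classSize-∷ʳ c x ⟩
  classSize c + flipCount c x   ≡⟨ cong (_+_ (classSize c)) (countWords-none _ noFlip) ⟩
  classSize c + 0               ≡⟨ ℕ.+-identityʳ (classSize c) ⟩
  classSize c                   ∎

classSize-∷ʳ-≤ : ∀ (c : Vec Bool n) x → classSize c ≤ classSize (c ∷ʳ x)
classSize-∷ʳ-≤ c x = subst (classSize c ≤_) (sym (classSize-∷ʳ c x)) (ℕ.m≤m+n _ _)

classSize-∷ʳ-< : ∀ (c : Vec Bool n) x → (∃[ d ] d ∷ʳ not x ~ c ∷ʳ x) →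
                 classSize c < classSize (c ∷ʳ x)
classSize-∷ʳ-< c x (d , flip) =
  subst (classSize c <_) (sym (classSize-∷ʳ c x)) (ℕ.m<m+n _ (countWords-pos _ {d} flip))

classSize-<-∷ʳ00 : ∀ (c : Vec Bool n) →
                   (∃[ d ] d ∷ʳ true ~ c ∷ʳ false) ⊎ (∃[ e ] e ∷ʳ true ~ c ∷ʳ false ∷ʳ false) →
                   classSize c < classSize (c ∷ʳ false ∷ʳ false)
classSize-<-∷ʳ00 c (inj₁ flip) =
  ℕ.<-≤-trans (classSize-∷ʳ-< c false flip) (classSize-∷ʳ-≤ (c ∷ʳ false) false)
classSize-<-∷ʳ00 c (inj₂ flip) =
  ℕ.≤-<-trans (classSize-∷ʳ-≤ c false) (classSize-∷ʳ-< (c ∷ʳ false) false flip)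

-- Reading a word from the left: ones as long as no 0 has been read, has011 from the first 011 on.
data Suffix : Set where
  ones ends0 ends01 has011 : Suffix

δ : Suffix → Bool → Suffix
δ ones   false = ends0
δ ones   true  = ones
δ ends0  false = ends0
δ ends0  true  = ends01
δ ends01 false = ends0
δ ends01 true  = has011
δ has011 _     = has011

scan : Suffix → List Bool → Suffix
scan = foldl δ

shortest : Suffix → List Bool
shortest ones   = []
shortest ends0  = false ∷ []
shortest ends01 = false ∷ true ∷ []
shortest has011 = false ∷ true ∷ true ∷ []

Has011 : List Bool → Set
Has011 ws = ∃[ xs ] ∃[ ys ] ws ≡ xs ++ (false ∷ true ∷ true ∷ []) ++ ys

Has011-∷ : ∀ {x ws} → Has011 ws → Has011 (x ∷ ws)
Has011-∷ {x} (xs , ys , eq) = x ∷ xs , ys , cong (x ∷_) eq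

scan-has011 : ∀ s ws → scan s ws ≡ has011 → Has011 (shortest s ++ ws)
scan-has011 has011 ws           _  = [] , ws , refl
scan-has011 ones   []           ()
scan-has011 ends0  []           ()
scan-has011 ends01 []           ()
scan-has011 ones   (false ∷ ws) eq = scan-has011 ends0 ws eq
scan-has011 ones   (true  ∷ ws) eq = Has011-∷ (scan-has011 ones ws eq)
scan-has011 ends0  (false ∷ ws) eq = Has011-∷ (scan-has011 ends0 ws eq)
scan-has011 ends0  (true  ∷ ws) eq = scan-has011 ends01 ws eq
scan-has011 ends01 (false ∷ ws) eq = Has011-∷ (Has011-∷ (scan-has011 ends0 ws eq))
scan-has011 ends01 (true  ∷ ws) eq = scan-has011 has011 ws eq

greedy⇒scan≢has011 : ∀ (w : Vec Bool m) → Greedy w → scan ones (toList w) ≢ has011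
greedy⇒scan≢has011 w greedy dead = greedy (scan-has011 ones (toList w) dead)

scan-∷ʳ : ∀ s (w : Vec Bool m) x → scan s (toList (w ∷ʳ x)) ≡ δ (scan s (toList w)) x
scan-∷ʳ s w x = trans (cong (scan s) (Vec.toList-∷ʳ x w)) (List.foldl-∷ʳ δ s x (toList w))

-- (X , Y) stands for X + Yφ, so that next D e = φ D + e because φ (X + Yφ) = Y + (X + Y) φ.
next : ℤ × ℤ → ℤ → ℤ × ℤ
next (X , Y) e = (Y ℤ.+ e , X ℤ.+ Y)

diff : ℕ × ℕ → ℕ × ℕ → ℤ × ℤ
diff (a , b) (a′ , b′) = (a ⊖ a′ , b ⊖ b′)

+-⊖-+ : ∀ a b a′ b′ → (a + b) ⊖ (a′ + b′) ≡ (a ⊖ a′) ℤ.+ (b ⊖ b′)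
+-⊖-+ a b a′ b′ = begin
  (a + b) ⊖ (a′ + b′)                   ≡⟨ ℤ.[+m]-[+n]≡m⊖n (a + b) (a′ + b′) ⟨
  + (a + b) ℤ.- + (a′ + b′)             ≡⟨ cong₂ ℤ._-_ (ℤ.pos-+ a b) (ℤ.pos-+ a′ b′) ⟩
  (+ a ℤ.+ + b) ℤ.- (+ a′ ℤ.+ + b′)     ≡⟨ interchange-− (+ a) (+ b) (+ a′) (+ b′) ⟩
  (+ a ℤ.- + a′) ℤ.+ (+ b ℤ.- + b′)     ≡⟨ cong₂ ℤ._+_ (ℤ.[+m]-[+n]≡m⊖n a a′) (ℤ.[+m]-[+n]≡m⊖n b b′) ⟩
  (a ⊖ a′) ℤ.+ (b ⊖ b′)                 ∎
  where
  interchange-− : ∀ i j k l → (i ℤ.+ j) ℤ.- (k ℤ.+ l) ≡ (i ℤ.- k) ℤ.+ (j ℤ.- l)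
  interchange-− = ℤ-Solver.solve-∀

diff-horner : ∀ v w x y → diff (horner v [ x ]) (horner w [ y ]) ≡ next (diff v w) (bit x ⊖ bit y)
diff-horner (a , b) (a′ , b′) x y = cong₂ _,_ (+-⊖-+ b (bit x) b′ (bit y)) (+-⊖-+ a b a′ b′)

diff-self : ∀ v → diff v v ≡ (0ℤ , 0ℤ)
diff-self (a , b) = cong₂ _,_ (ℤ.n⊖n≡0 a) (ℤ.n⊖n≡0 b)

+≡0⇒≡- : ∀ {i j} → i ℤ.+ j ≡ 0ℤ → i ≡ ℤ.- j
+≡0⇒≡- {i} {j} i+j≡0 = begin
  i                    ≡⟨ cancel i j ⟩
  (i ℤ.+ j) ℤ.- j      ≡⟨ cong (ℤ._- j) i+j≡0 ⟩
  0ℤ ℤ.- j             ≡⟨ ℤ.+-identityˡ (ℤ.- j) ⟩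
  ℤ.- j                ∎
  where
  cancel : ∀ i j → i ≡ (i ℤ.+ j) ℤ.- j
  cancel = ℤ-Solver.solve-∀

next≡0⇒ : ∀ {D e} → next D e ≡ (0ℤ , 0ℤ) → D ≡ (e , ℤ.- e)
next≡0⇒ {X , Y} {e} eq = cong₂ _,_ X≡e Y≡-e
  where
  Y≡-e : Y ≡ ℤ.- e
  Y≡-e = +≡0⇒≡- (cong proj₁ eq)
  X≡e : X ≡ e
  X≡e = trans (+≡0⇒≡- (cong proj₂ eq)) (trans (cong ℤ.-_ Y≡-e) (ℤ.neg-involutive e))

∷ʳ~∷ʳ⇒diff : ∀ (d c : Vec Bool m) x y → d ∷ʳ x ~ c ∷ʳ y →
             diff (value d) (value c) ≡ (bit x ⊖ bit y , ℤ.- (bit x ⊖ bit y))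
∷ʳ~∷ʳ⇒diff d c x y dx~cy = next≡0⇒ (begin
  next (diff (value d) (value c)) (bit x ⊖ bit y)          ≡⟨ diff-horner (value d) (value c) x y ⟨
  diff (horner (value d) [ x ]) (horner (value c) [ y ])   ≡⟨ cong₂ diff (value-∷ʳ d x) (value-∷ʳ c y) ⟨
  diff (value (d ∷ʳ x)) (value (c ∷ʳ y))                   ≡⟨ cong (λ v → diff v (value (c ∷ʳ y))) dx~cy ⟩
  diff (value (c ∷ʳ y)) (value (c ∷ʳ y))                   ≡⟨ diff-self (value (c ∷ʳ y)) ⟩
  (0ℤ , 0ℤ)                                                ∎)

Far : ℤ × ℤ → Set
Far (X , Y) = (0ℤ ℤ.≤ X × 1ℤ ℤ.≤ Y) ⊎ (X ℤ.≤ 0ℤ × Y ℤ.≤ -1ℤ)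

-1≤bit⊖bit : ∀ x y → -1ℤ ℤ.≤ bit x ⊖ bit y
-1≤bit⊖bit false false = ℤ.-≤+
-1≤bit⊖bit false true  = ℤ.≤-refl
-1≤bit⊖bit true  false = ℤ.-≤+
-1≤bit⊖bit true  true  = ℤ.-≤+

bit⊖bit≤1 : ∀ x y → bit x ⊖ bit y ℤ.≤ 1ℤ
bit⊖bit≤1 false false = ℤ.+≤+ z≤n
bit⊖bit≤1 false true  = ℤ.-≤+
bit⊖bit≤1 true  false = ℤ.≤-refl
bit⊖bit≤1 true  true  = ℤ.+≤+ z≤n

Far-next : ∀ {D} → Far D → ∀ x y → Far (next D (bit x ⊖ bit y))
Far-next (inj₁ (0≤X , 1≤Y))  x y = inj₁ (ℤ.+-mono-≤ 1≤Y (-1≤bit⊖bit x y) , ℤ.+-mono-≤ 0≤X 1≤Y)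
Far-next (inj₂ (X≤0 , Y≤-1)) x y = inj₂ (ℤ.+-mono-≤ Y≤-1 (bit⊖bit≤1 x y) , ℤ.+-mono-≤ X≤0 Y≤-1)

-- The differences outside Far that occur in each state, found by exhaustive search from (0 , 0).
window : Suffix → List (ℤ × ℤ)
window ones   = (-1ℤ , 0ℤ) ∷ (0ℤ , 0ℤ) ∷ []
window ends0  = (-1ℤ , 0ℤ) ∷ (0ℤ , 0ℤ) ∷ (1ℤ , -[1+ 1 ]) ∷ (1ℤ , -1ℤ) ∷ (1ℤ , 0ℤ) ∷ (+ 2 , 0ℤ) ∷ []
window ends01 = (-[1+ 1 ] , 0ℤ) ∷ (-1ℤ , 0ℤ) ∷ (-1ℤ , 1ℤ) ∷ (-1ℤ , + 2) ∷ (0ℤ , 0ℤ) ∷ []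
window has011 = []

Reachable : Suffix → ℤ × ℤ → Set
Reachable s D = s ≡ has011 ⊎ Far D ⊎ D ∈ window s

far? : ∀ D → Dec (Far D)
far? (X , Y) = (0ℤ ℤ.≤? X ×-dec 1ℤ ℤ.≤? Y) ⊎-dec (X ℤ.≤? 0ℤ ×-dec Y ℤ.≤? -1ℤ)

has011? : ∀ s → Dec (s ≡ has011)
has011? ones   = no λ ()
has011? ends0  = no λ ()
has011? ends01 = no λ ()
has011? has011 = yes refl

reachable? : ∀ s D → Dec (Reachable s D)
reachable? s D = has011? s ⊎-dec far? D ⊎-dec D ∈? window s

∀-Bool? : ∀ {p} {P : Bool → Set p} → (∀ b → Dec (P b)) → Dec (∀ b → P b)
∀-Bool? P? =
  map′ (λ (f , t) → λ { false → f ; true → t }) (λ h → h false , h true) (P? false ×-dec P? true)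

StepClosed : Suffix → ℤ × ℤ → Set
StepClosed s D = ∀ x y → Reachable (δ s y) (next D (bit x ⊖ bit y))

stepClosed? : ∀ s D → Dec (StepClosed s D)
stepClosed? s D = ∀-Bool? λ x → ∀-Bool? λ y → reachable? (δ s y) (next D (bit x ⊖ bit y))

window-stepClosed : ∀ s → All (StepClosed s) (window s)
window-stepClosed ones   = from-yes (All.all? (stepClosed? ones) (window ones))
window-stepClosed ends0  = from-yes (All.all? (stepClosed? ends0) (window ends0))
window-stepClosed ends01 = from-yes (All.all? (stepClosed? ends01) (window ends01))
window-stepClosed has011 = All.[]

Reachable-next : ∀ s D → Reachable s D → StepClosed s D
Reachable-next s D (inj₁ refl)           x y = inj₁ refl
Reachable-next s D (inj₂ (inj₁ far))     x y = inj₂ (inj₁ (Far-next far x y))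
Reachable-next s D (inj₂ (inj₂ D∈window))    = All.lookup (window-stepClosed s) D∈window

reachable-diff : ∀ (d c : Vec Bool m) → Reachable (scan ones (toList c)) (diff (value d) (value c))
reachable-diff d c = go d c (from-yes (reachable? ones (0ℤ , 0ℤ)))
  where
  go : ∀ {m} (us ws : Vec Bool m) {v w s} → Reachable s (diff v w) →
       Reachable (scan s (toList ws)) (diff (horner v (toList us)) (horner w (toList ws)))
  go []       []       r = r
  go (x ∷ us) (y ∷ ws) {v} {w} {s} r =
    go us ws (subst (Reachable (δ s y)) (sym (diff-horner v w x y)) (Reachable-next s _ r x y))

φ⁻¹ −φ⁻¹ : ℤ × ℤ
φ⁻¹  = (-1ℤ , 1ℤ)
−φ⁻¹ = (1ℤ , -1ℤ)

reachable-φ⁻¹⇒δ1≡has011 : ∀ s → Reachable s φ⁻¹ → δ s true ≡ has011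
reachable-φ⁻¹⇒δ1≡has011 ones   r = contradiction r (from-no (reachable? ones φ⁻¹))
reachable-φ⁻¹⇒δ1≡has011 ends0  r = contradiction r (from-no (reachable? ends0 φ⁻¹))
reachable-φ⁻¹⇒δ1≡has011 ends01 _ = refl
reachable-φ⁻¹⇒δ1≡has011 has011 _ = refl

reachable-δ1-−φ⁻¹⇒δ1≡has011 : ∀ s → Reachable (δ s true) −φ⁻¹ → δ s true ≡ has011
reachable-δ1-−φ⁻¹⇒δ1≡has011 ones   r = contradiction r (from-no (reachable? ones −φ⁻¹))
reachable-δ1-−φ⁻¹⇒δ1≡has011 ends0  r = contradiction r (from-no (reachable? ends01 −φ⁻¹))
reachable-δ1-−φ⁻¹⇒δ1≡has011 ends01 _ = refl
reachable-δ1-−φ⁻¹⇒δ1≡has011 has011 _ = refl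

greedy-∷ʳ1⇒no-flip : ∀ (c d : Vec Bool n) → Greedy (c ∷ʳ true) → ¬ d ∷ʳ false ~ c ∷ʳ true
greedy-∷ʳ1⇒no-flip c d greedy d0~c1 = greedy⇒scan≢has011 (c ∷ʳ true) greedy (begin
  scan ones (toList (c ∷ʳ true)) ≡⟨ scan-∷ʳ ones c true ⟩
  δ (scan ones (toList c)) true  ≡⟨ reachable-φ⁻¹⇒δ1≡has011 _ φ⁻¹-reached ⟩
  has011                         ∎)
  where
  φ⁻¹-reached : Reachable (scan ones (toList c)) φ⁻¹
  φ⁻¹-reached = subst (Reachable _) (∷ʳ~∷ʳ⇒diff d c false true d0~c1) (reachable-diff d c)

inG1-∷ʳ0⇒no-flip : ∀ (c d : Vec Bool n) → InG 1 (c ∷ʳ false) → ¬ d ∷ʳ true ~ c ∷ʳ false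
inG1-∷ʳ0⇒no-flip c d (greedy , p , c0≡p10) d1~c0 = greedy⇒scan≢has011 (c ∷ʳ false) greedy (begin
  scan ones (toList (c ∷ʳ false)) ≡⟨ scan-∷ʳ ones c false ⟩
  δ (scan ones (toList c)) false  ≡⟨ cong (λ s → δ s false) scan-c≡has011 ⟩
  has011                          ∎)
  where
  c≡p1 : toList c ≡ p List.∷ʳ true
  c≡p1 = List.∷ʳ-injectiveˡ (toList c) (p List.∷ʳ true) (begin
    toList c List.∷ʳ false     ≡⟨ Vec.toList-∷ʳ false c ⟨
    toList (c ∷ʳ false)        ≡⟨ c0≡p10 ⟩
    p ++ true ∷ false ∷ []     ≡⟨ List.++-assoc p [ true ] [ false ] ⟨
    p List.∷ʳ true List.∷ʳ false ∎)
  scan-c≡δ1 : scan ones (toList c) ≡ δ (scan ones p) true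
  scan-c≡δ1 = trans (cong (scan ones) c≡p1) (List.foldl-∷ʳ δ ones true p)
  −φ⁻¹-reached : Reachable (δ (scan ones p) true) −φ⁻¹
  −φ⁻¹-reached = subst₂ Reachable scan-c≡δ1 (∷ʳ~∷ʳ⇒diff d c true false d1~c0) (reachable-diff d c)
  scan-c≡has011 : scan ones (toList c) ≡ has011
  scan-c≡has011 = trans scan-c≡δ1 (reachable-δ1-−φ⁻¹⇒δ1≡has011 (scan ones p) −φ⁻¹-reached)

1∈-∷ʳ0 : ∀ (c : Vec Bool n) → true ∈ toList (c ∷ʳ false) → true ∈ toList c
1∈-∷ʳ0 c 1∈c0 with ∈-++⁻ (toList c) (subst (true ∈_) (Vec.toList-∷ʳ false c) 1∈c0)
... | inj₁ 1∈c        = 1∈c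
... | inj₂ (here ())
... | inj₂ (there ())

1∈⇒flip-∷ʳ0-or-∷ʳ00 : ∀ (c : Vec Bool n) → true ∈ toList c →
                      (∃[ d ] d ∷ʳ true ~ c ∷ʳ false) ⊎ (∃[ e ] e ∷ʳ true ~ c ∷ʳ false ∷ʳ false)
1∈⇒flip-∷ʳ0-or-∷ʳ00 {zero}  []  ()
1∈⇒flip-∷ʳ0-or-∷ʳ00 {suc n} c 1∈c with initLast c
... | c′ , true  , refl = inj₂ (c′ ∷ʳ false ∷ʳ true , 011~100 c′)
... | c′ , false , refl with 1∈⇒flip-∷ʳ0-or-∷ʳ00 c′ (1∈-∷ʳ0 c′ 1∈c)
...   | inj₁ (d , d1~c′0)  = inj₂ (d ∷ʳ false ∷ʳ true , trans (011~100 d) d100~c′000)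
      where
      d100~c′000 : d ∷ʳ true ∷ʳ false ∷ʳ false ~ c′ ∷ʳ false ∷ʳ false ∷ʳ false
      d100~c′000 = ~-∷ʳ (d ∷ʳ true ∷ʳ false) (c′ ∷ʳ false ∷ʳ false) false
                          (~-∷ʳ (d ∷ʳ true) (c′ ∷ʳ false) false d1~c′0)
...   | inj₂ (e , e1~c′00) = inj₁ (e , e1~c′00)

proposition2p2 : (n : ℕ) → (c : Vec Bool n) →
    (InG 0 (c ∷ʳ true) → classSize (c ∷ʳ true) ≡ classSize c)
    × (InG 1 (c ∷ʳ false) → classSize (c ∷ʳ false) ≡ classSize c)
    × ((∃[ h ] InG h c) → classSize ((c ∷ʳ false) ∷ʳ false) ≥ classSize c + 1)
proposition2p2 n c =
    (λ (greedy , _) → classSize-∷ʳ-≡ c true λ d → greedy-∷ʳ1⇒no-flip c d greedy)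
  , (λ c0∈G¹ → classSize-∷ʳ-≡ c false λ d → inG1-∷ʳ0⇒no-flip c d c0∈G¹)
  , λ (_ , _ , p , c≡p10ʰ) →
      let 1∈c = subst (true ∈_) (sym c≡p10ʰ) (∈-++⁺ʳ p (here refl)) in
      subst (_≤ classSize (c ∷ʳ false ∷ʳ false)) (ℕ.+-comm 1 (classSize c))
            (classSize-<-∷ʳ00 c (1∈⇒flip-∷ʳ0-or-∷ʳ00 c 1∈c))
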